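{- Let $S$ be a Kleene relation algebra satisfying the Tarski rule, let $p \in S$ be such that $p \sqcap \overline{1}$ is acyclic, and let $w, y \in S$ be points with $y \sqcap (p^*\cdot w) = \bot$. Then $\big((w \sqcap y^T) \sqcup (\overline{w} \sqcap p)\big) \sqcap \overline{1}$ is acyclic.
   Context: A Kleene relation algebra is a structure $(S,\sqcup,\sqcap,\cdot,\overline{\phantom{x}},{}^T,{}^*,\bot,\top,1)$ such that $(S,\sqcup,\sqcap,\overline{\phantom{x}},\bot,\top)$ is a Boolean algebra with order $x \sqsubseteq y \iff x \sqcup y = y$; $(S,\sqcup,\cdot,\bot,1)$ is an idempotent semiring ($\cdot$ associative with two-sided unit $1$, distributing over $\sqcup$, $\bot$ a two-sided zero of $\cdot$); transposition satisfies $(x\sqcup y)^T = x^T \sqcup y^T$, $(x^T)^T = x$, $(x\cdot y)^T = y^T\cdot x^T$ and $(x\cdot y)\sqcap z \sqsubseteq x\cdot(y\sqcap(x^T\cdot z))$; and the star satisfies $1\sqcup y\cdot y^* = y^* = 1 \sqcup y^*\cdot y$, $z\sqcup y\cdot x\sqsubseteq x \Rightarrow y^*\cdot z\sqsubseteq x$, $z \sqcup x\cdot y \sqsubseteq x \Rightarrow z\cdot y^*\sqsubseteq x$. The Tarski rule states $\top\cdot x\cdot\top = \top$ for every $x \neq \bot$. Write $x^+ = x\cdot x^*$. An element $x$ is acyclic if $x^+\sqsubseteq\overline{1}$, injective if $x x^T\sqsubseteq 1$, surjective if $1\sqsubseteq x^T x$, a vector if $x\cdot\top = x$, and a point if it is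 an injective surjective vector. -}

module Defs where

open import Level using (Level) renaming (suc to lsuc)
open import Relation.Binary.PropositionalEquality using (_≡_)
open import Relation.Nullary using (¬_)

record KleeneRelationAlgebra (c : Level) : Set (lsuc c) where
  infixr 6 _⊔_
  infixr 7 _⊓_
  infixr 8 _·_
  infix 4 _⊑_
  field
    S    : Set c
    _⊔_  : S → S → S
    _⊓_  : S → S → S
    _·_  : S → S → S
    ‾    : S → S
    _ᵀ   : S → S
    _*   : S → S
    bot  : S
    top  : S
    one  : S

  _⊑_ : S → S → Set c
  x ⊑ y = x ⊔ y ≡ y

  field
    ⊔-assoc    : ∀ x y z → (x ⊔ y) ⊔ z ≡ x ⊔ (y ⊔ z)
    ⊔-comm     : ∀ x y → x ⊔ y ≡ y ⊔ x
    ⊓-assoc    : ∀ x y z → (x ⊓ y) ⊓ z ≡ x ⊓ (y ⊓ z)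
    ⊓-comm     : ∀ x y → x ⊓ y ≡ y ⊓ x
    ⊔-absorb   : ∀ x y → x ⊔ (x ⊓ y) ≡ x
    ⊓-absorb   : ∀ x y → x ⊓ (x ⊔ y) ≡ x
    ⊓-distrib-⊔ : ∀ x y z → x ⊓ (y ⊔ z) ≡ (x ⊓ y) ⊔ (x ⊓ z)
    ⊔-bot      : ∀ x → x ⊔ bot ≡ x
    ⊓-top      : ∀ x → x ⊓ top ≡ x
    compl-⊔    : ∀ x → x ⊔ ‾ x ≡ top
    compl-⊓    : ∀ x → x ⊓ ‾ x ≡ bot
    ⊔-idem     : ∀ x → x ⊔ x ≡ x
    ·-assoc    : ∀ x y z → (x · y) · z ≡ x · (y · z)
    ·-identityˡ : ∀ x → one · x ≡ x
    ·-identityʳ : ∀ x → x · one ≡ x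
    ·-distribˡ : ∀ x y z → x · (y ⊔ z) ≡ (x · y) ⊔ (x · z)
    ·-distribʳ : ∀ x y z → (y ⊔ z) · x ≡ (y · x) ⊔ (z · x)
    ·-zeroˡ    : ∀ x → bot · x ≡ bot
    ·-zeroʳ    : ∀ x → x · bot ≡ bot
    ᵀ-⊔        : ∀ x y → (x ⊔ y) ᵀ ≡ (x ᵀ) ⊔ (y ᵀ)
    ᵀ-invol    : ∀ x → (x ᵀ) ᵀ ≡ x
    ᵀ-·        : ∀ x y → (x · y) ᵀ ≡ (y ᵀ) · (x ᵀ)
    dedekind   : ∀ x y z → (x · y) ⊓ z ⊑ x · (y ⊓ ((x ᵀ) · z))
    star-unfoldˡ : ∀ y → one ⊔ (y · (y *)) ≡ y *
    star-unfoldʳ : ∀ y → one ⊔ ((y *) · y) ≡ y *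
    star-inductˡ : ∀ x y z → z ⊔ (y · x) ⊑ x → (y *) · z ⊑ x
    star-inductʳ : ∀ x y z → z ⊔ (x · y) ⊑ x → z · (y *) ⊑ x

  _⁺ : S → S
  x ⁺ = x · (x *)

  acyclic : S → Set c
  acyclic x = x ⁺ ⊑ ‾ one

  injective : S → Set c
  injective x = x · (x ᵀ) ⊑ one

  surjective : S → Set c
  surjective x = one ⊑ (x ᵀ) · x

  vector : S → Set c
  vector x = x · top ≡ x

  record point (x : S) : Set c where
    field
      point-injective  : injective x
      point-surjective : surjective x
      point-vector     : vector x

  TarskiRule : Set c
  TarskiRule = ∀ x → ¬ (x ≡ bot) → (top · x) · top ≡ top

-- Put a = w ⊓ yᵀ and b = (‾ w ⊓ p) ⊓ ‾ 1, so that the relation in question lies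
-- below a ⊔ b, with a ⊑ w · yᵀ (w and y are vectors) and b ⊑ p ⊓ ‾ 1. Since y is
-- disjoint from p* · w we get yᵀ · b* · w = ⊥, hence a · b* · a = ⊥: a path uses
-- an a-edge at most once, and (a ⊔ b)⁺ ⊑ b⁺ ⊔ b* · a · b*. The first part is
-- irreflexive because p ⊓ ‾ 1 is acyclic; the second lies below (b* · w) · (yᵀ · b*),
-- which is irreflexive because the reversed product (yᵀ · b*) · (b* · w) is ⊥.
module Submission where

open import Defs
open import Level using (Level)
open import Relation.Binary.Bundles using (Poset)
open import Relation.Binary.PropositionalEquality
  using (_≡_; refl; sym; trans; cong; cong₂; isEquivalence)
import Relation.Binary.Reasoning.PartialOrder as PosetReasoning

module KleeneRelationAlgebraProperties {c : Level} (K : KleeneRelationAlgebra c) where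
  open KleeneRelationAlgebra K

  ⊑-reflexive : ∀ {x y} → x ≡ y → x ⊑ y
  ⊑-reflexive {y = y} refl = ⊔-idem y

  ⊑-trans : ∀ {x y z} → x ⊑ y → y ⊑ z → x ⊑ z
  ⊑-trans {x} {y} {z} x⊑y y⊑z =
    trans (cong (x ⊔_) (sym y⊑z))
      (trans (sym (⊔-assoc x y z)) (trans (cong (_⊔ z) x⊑y) y⊑z))

  ⊑-antisym : ∀ {x y} → x ⊑ y → y ⊑ x → x ≡ y
  ⊑-antisym {x} {y} x⊑y y⊑x = trans (sym y⊑x) (trans (⊔-comm y x) x⊑y)

  ⊑-poset : Poset c c c
  ⊑-poset = record
    { Carrier        = S
    ; _≈_            = _≡_
    ; _≤_            = _⊑_
    ; isPartialOrder = record
      { isPreorder = record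
        { isEquivalence = isEquivalence
        ; reflexive     = ⊑-reflexive
        ; trans         = ⊑-trans
        }
      ; antisym    = ⊑-antisym
      }
    }

  open PosetReasoning ⊑-poset

  x⊑x⊔y : ∀ {x y} → x ⊑ x ⊔ y
  x⊑x⊔y {x} {y} = trans (sym (⊔-assoc x x y)) (cong (_⊔ y) (⊔-idem x))

  y⊑x⊔y : ∀ {x y} → y ⊑ x ⊔ y
  y⊑x⊔y {x} {y} = trans (cong (y ⊔_) (⊔-comm x y)) (trans x⊑x⊔y (⊔-comm y x))

  ⊔-lub : ∀ {x y z} → x ⊑ z → y ⊑ z → x ⊔ y ⊑ z
  ⊔-lub {x} {y} {z} x⊑z y⊑z = trans (⊔-assoc x y z) (trans (cong (x ⊔_) y⊑z) x⊑z)

  ⊓≡⇒⊑ : ∀ {x y} → x ⊓ y ≡ x → x ⊑ y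
  ⊓≡⇒⊑ {x} {y} e =
    trans (cong (_⊔ y) (sym e))
      (trans (⊔-comm (x ⊓ y) y) (trans (cong (y ⊔_) (⊓-comm x y)) (⊔-absorb y x)))

  ⊑⇒⊓≡ : ∀ {x y} → x ⊑ y → x ⊓ y ≡ x
  ⊑⇒⊓≡ {x} x⊑y = trans (cong (x ⊓_) (sym x⊑y)) (⊓-absorb x _)

  x⊓y⊑x : ∀ {x y} → x ⊓ y ⊑ x
  x⊓y⊑x {x} {y} = trans (⊔-comm (x ⊓ y) x) (⊔-absorb x y)

  x⊓y⊑y : ∀ {x y} → x ⊓ y ⊑ y
  x⊓y⊑y {x} {y} = ⊑-trans (⊑-reflexive (⊓-comm x y)) x⊓y⊑x

  ⊓-glb : ∀ {x y z} → z ⊑ x → z ⊑ y → z ⊑ x ⊓ y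
  ⊓-glb {x} {y} {z} z⊑x z⊑y =
    ⊓≡⇒⊑ (trans (sym (⊓-assoc z x y)) (trans (cong (_⊓ y) (⊑⇒⊓≡ z⊑x)) (⊑⇒⊓≡ z⊑y)))

  ⊓-distribʳ-⊔ : ∀ x y z → (y ⊔ z) ⊓ x ≡ (y ⊓ x) ⊔ (z ⊓ x)
  ⊓-distribʳ-⊔ x y z =
    trans (⊓-comm (y ⊔ z) x) (trans (⊓-distrib-⊔ x y z) (cong₂ _⊔_ (⊓-comm x y) (⊓-comm x z)))

  bot-min : ∀ {x} → bot ⊑ x
  bot-min {x} = trans (⊔-comm bot x) (⊔-bot x)

  top-max : ∀ {x} → x ⊑ top
  top-max {x} = ⊓≡⇒⊑ (⊓-top x)

  ⊑bot⇒≡bot : ∀ {x} → x ⊑ bot → x ≡ bot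
  ⊑bot⇒≡bot {x} x⊑bot = trans (sym (⊔-bot x)) x⊑bot

  ⊓≡bot⇒⊑‾ : ∀ {x y} → x ⊓ y ≡ bot → x ⊑ ‾ y
  ⊓≡bot⇒⊑‾ {x} {y} x⊓y≡bot = ⊓≡⇒⊑ (sym (begin-equality
    x                       ≡⟨ ⊓-top x ⟨
    x ⊓ top                 ≡⟨ cong (x ⊓_) (compl-⊔ y) ⟨
    x ⊓ (y ⊔ ‾ y)           ≡⟨ ⊓-distrib-⊔ x y (‾ y) ⟩
    (x ⊓ y) ⊔ (x ⊓ ‾ y)     ≡⟨ cong (_⊔ (x ⊓ ‾ y)) x⊓y≡bot ⟩
    bot ⊔ (x ⊓ ‾ y)         ≡⟨ ⊔-comm bot _ ⟩
    (x ⊓ ‾ y) ⊔ bot         ≡⟨ ⊔-bot _ ⟩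
    x ⊓ ‾ y                 ∎))

  ·-monoˡ : ∀ {x y z} → x ⊑ y → x · z ⊑ y · z
  ·-monoˡ {x} {y} {z} x⊑y = trans (sym (·-distribʳ z x y)) (cong (_· z) x⊑y)

  ·-monoʳ : ∀ {x y z} → x ⊑ y → z · x ⊑ z · y
  ·-monoʳ {x} {y} {z} x⊑y = trans (sym (·-distribˡ z x y)) (cong (z ·_) x⊑y)

  ·-mono : ∀ {x y u v} → x ⊑ y → u ⊑ v → x · u ⊑ y · v
  ·-mono x⊑y u⊑v = ⊑-trans (·-monoˡ x⊑y) (·-monoʳ u⊑v)

  ᵀ-mono : ∀ {x y} → x ⊑ y → x ᵀ ⊑ y ᵀ
  ᵀ-mono {x} {y} x⊑y = trans (sym (ᵀ-⊔ x y)) (cong _ᵀ x⊑y)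

  ᵀ-reflects-⊑ : ∀ {x y} → x ᵀ ⊑ y ᵀ → x ⊑ y
  ᵀ-reflects-⊑ {x} {y} xᵀ⊑yᵀ = begin
    x           ≡⟨ ᵀ-invol x ⟨
    (x ᵀ) ᵀ     ≤⟨ ᵀ-mono xᵀ⊑yᵀ ⟩
    (y ᵀ) ᵀ     ≡⟨ ᵀ-invol y ⟩
    y           ∎

  ᵀ-⊓ : ∀ x y → (x ⊓ y) ᵀ ≡ x ᵀ ⊓ y ᵀ
  ᵀ-⊓ x y = ⊑-antisym (⊓-glb (ᵀ-mono x⊓y⊑x) (ᵀ-mono x⊓y⊑y)) (ᵀ-reflects-⊑ (begin
    (x ᵀ ⊓ y ᵀ) ᵀ         ≤⟨ ⊓-glb (ᵀ-mono x⊓y⊑x) (ᵀ-mono x⊓y⊑y) ⟩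
    (x ᵀ) ᵀ ⊓ (y ᵀ) ᵀ     ≡⟨ cong₂ _⊓_ (ᵀ-invol x) (ᵀ-invol y) ⟩
    x ⊓ y                 ≡⟨ ᵀ-invol (x ⊓ y) ⟨
    ((x ⊓ y) ᵀ) ᵀ         ∎))

  top-ᵀ : top ᵀ ≡ top
  top-ᵀ = ⊑-antisym top-max (ᵀ-reflects-⊑ {top} {top ᵀ} (⊑-trans top-max (⊑-reflexive (sym (ᵀ-invol top)))))

  bot-ᵀ : bot ᵀ ≡ bot
  bot-ᵀ = ⊑bot⇒≡bot (ᵀ-reflects-⊑ {bot ᵀ} {bot} (⊑-trans (⊑-reflexive (ᵀ-invol bot)) bot-min))

  dedekindʳ : ∀ x y z → (x · y) ⊓ z ⊑ (x ⊓ z · y ᵀ) · y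
  dedekindʳ x y z = ᵀ-reflects-⊑ (begin
    ((x · y) ⊓ z) ᵀ                  ≡⟨ ᵀ-⊓ (x · y) z ⟩
    (x · y) ᵀ ⊓ z ᵀ                  ≡⟨ cong (_⊓ z ᵀ) (ᵀ-· x y) ⟩
    y ᵀ · x ᵀ ⊓ z ᵀ                  ≤⟨ dedekind (y ᵀ) (x ᵀ) (z ᵀ) ⟩
    y ᵀ · (x ᵀ ⊓ (y ᵀ) ᵀ · z ᵀ)      ≡⟨ cong (λ t → y ᵀ · (x ᵀ ⊓ t)) (ᵀ-· z (y ᵀ)) ⟨
    y ᵀ · (x ᵀ ⊓ (z · y ᵀ) ᵀ)        ≡⟨ cong (y ᵀ ·_) (ᵀ-⊓ x (z · y ᵀ)) ⟨
    y ᵀ · (x ⊓ z · y ᵀ) ᵀ            ≡⟨ ᵀ-· (x ⊓ z · y ᵀ) y ⟨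
    ((x ⊓ z · y ᵀ) · y) ᵀ            ∎)

  one⊑x* : ∀ {x} → one ⊑ x *
  one⊑x* {x} = ⊑-trans x⊑x⊔y (⊑-reflexive (star-unfoldˡ x))

  x·x*⊑x* : ∀ {x} → x · x * ⊑ x *
  x·x*⊑x* {x} = ⊑-trans y⊑x⊔y (⊑-reflexive (star-unfoldˡ x))

  x*·x⊑x* : ∀ {x} → x * · x ⊑ x *
  x*·x⊑x* {x} = ⊑-trans y⊑x⊔y (⊑-reflexive (star-unfoldʳ x))

  x*·x*⊑x* : ∀ {x} → x * · x * ⊑ x *
  x*·x*⊑x* {x} = star-inductˡ (x *) x (x *) (⊔-lub (⊔-idem (x *)) x·x*⊑x*)

  *-mono : ∀ {x y} → x ⊑ y → x * ⊑ y *
  *-mono {x} {y} x⊑y = ⊑-trans (⊑-reflexive (sym (·-identityʳ (x *))))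
    (star-inductˡ (y *) x one (⊔-lub one⊑x* (⊑-trans (·-monoˡ x⊑y) x·x*⊑x*)))

  x⊑x·y* : ∀ {x y} → x ⊑ x · y *
  x⊑x·y* {x} = ⊑-trans (⊑-reflexive (sym (·-identityʳ x))) (·-monoʳ one⊑x*)

  x⊑y*·x : ∀ {x y} → x ⊑ y * · x
  x⊑y*·x {x} = ⊑-trans (⊑-reflexive (sym (·-identityˡ x))) (·-monoˡ one⊑x*)

  ⁺-mono : ∀ {x y} → x ⊑ y → x ⁺ ⊑ y ⁺
  ⁺-mono x⊑y = ·-mono x⊑y (*-mono x⊑y)

  acyclic-anti : ∀ {x y} → x ⊑ y → acyclic y → acyclic x
  acyclic-anti x⊑y y-acyclic = ⊑-trans (⁺-mono x⊑y) y-acyclic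

  ⁺-⊔ : ∀ {a b} → a · (b * · a) ≡ bot → (a ⊔ b) ⁺ ⊑ b ⁺ ⊔ b * · (a · b *)
  ⁺-⊔ {a} {b} aba≡bot =
    star-inductʳ X (a ⊔ b) (a ⊔ b) (⊔-lub a⊔b⊑X X·[a⊔b]⊑X)
    where
    X : S
    X = b ⁺ ⊔ b * · (a · b *)

    a⊔b⊑X : a ⊔ b ⊑ X
    a⊔b⊑X = ⊔-lub (⊑-trans (⊑-trans x⊑x·y* x⊑y*·x) y⊑x⊔y) (⊑-trans x⊑x·y* x⊑x⊔y)

    X·a⊑X : X · a ⊑ X
    X·a⊑X = begin
      X · a                                              ≡⟨ ·-distribʳ a (b ⁺) _ ⟩
      b ⁺ · a ⊔ (b * · (a · b *)) · a                    ≡⟨ cong (b ⁺ · a ⊔_) (trans (·-assoc (b *) _ a)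
                                                              (cong (b * ·_) (trans (·-assoc a (b *) a) aba≡bot))) ⟩
      b ⁺ · a ⊔ b * · bot                                ≡⟨ cong (b ⁺ · a ⊔_) (·-zeroʳ (b *)) ⟩
      b ⁺ · a ⊔ bot                                      ≡⟨ ⊔-bot (b ⁺ · a) ⟩
      b ⁺ · a                                            ≤⟨ ·-mono x·x*⊑x* x⊑x·y* ⟩
      b * · (a · b *)                                    ≤⟨ y⊑x⊔y ⟩
      X                                                  ∎

    X·b⊑X : X · b ⊑ X
    X·b⊑X = begin
      X · b                                              ≡⟨ ·-distribʳ b (b ⁺) _ ⟩
      b ⁺ · b ⊔ (b * · (a · b *)) · b                    ≡⟨ cong₂ _⊔_ (·-assoc b (b *) b)
                                                              (trans (·-assoc (b *) _ b) (cong (b * ·_) (·-assoc a (b *) b))) ⟩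
      b · (b * · b) ⊔ b * · (a · (b * · b))              ≤⟨ ⊔-lub (⊑-trans (·-monoʳ x*·x⊑x*) x⊑x⊔y)
                                                              (⊑-trans (·-monoʳ (·-monoʳ x*·x⊑x*)) y⊑x⊔y) ⟩
      X                                                  ∎

    X·[a⊔b]⊑X : X · (a ⊔ b) ⊑ X
    X·[a⊔b]⊑X = ⊑-trans (⊑-reflexive (·-distribˡ X a b)) (⊔-lub X·a⊑X X·b⊑X)

  vector-⊓ᵀ : ∀ {w y} → vector w → vector y → w ⊓ y ᵀ ⊑ w · y ᵀ
  vector-⊓ᵀ {w} {y} w-vector y-vector = begin
    w ⊓ y ᵀ                   ≡⟨ ⊓-comm w (y ᵀ) ⟩
    y ᵀ ⊓ w                   ≡⟨ cong (λ t → t ᵀ ⊓ w) y-vector ⟨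
    (y · top) ᵀ ⊓ w           ≡⟨ cong (_⊓ w) (trans (ᵀ-· y top) (cong (_· y ᵀ) top-ᵀ)) ⟩
    top · y ᵀ ⊓ w             ≤⟨ dedekindʳ top (y ᵀ) w ⟩
    (top ⊓ w · (y ᵀ) ᵀ) · y ᵀ ≤⟨ ·-monoˡ x⊓y⊑y ⟩
    (w · (y ᵀ) ᵀ) · y ᵀ       ≡⟨ cong (λ t → (w · t) · y ᵀ) (ᵀ-invol y) ⟩
    (w · y) · y ᵀ             ≤⟨ ·-monoˡ (·-monoʳ top-max) ⟩
    (w · top) · y ᵀ           ≡⟨ cong (_· y ᵀ) w-vector ⟩
    w · y ᵀ                   ∎

  vector-⊓≡bot : ∀ {y z} → vector y → y ⊓ z ≡ bot → y ᵀ · z ≡ bot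
  vector-⊓≡bot {y} {z} y-vector y⊓z≡bot = ⊑bot⇒≡bot (begin
    y ᵀ · z                   ≤⟨ ⊓-glb (⊔-idem (y ᵀ · z)) top-max ⟩
    (y ᵀ · z) ⊓ top           ≤⟨ dedekind (y ᵀ) z top ⟩
    y ᵀ · (z ⊓ (y ᵀ) ᵀ · top) ≡⟨ cong (λ t → y ᵀ · (z ⊓ t)) (trans (cong (_· top) (ᵀ-invol y)) y-vector) ⟩
    y ᵀ · (z ⊓ y)             ≡⟨ cong (y ᵀ ·_) (trans (⊓-comm z y) y⊓z≡bot) ⟩
    y ᵀ · bot                 ≡⟨ ·-zeroʳ (y ᵀ) ⟩
    bot                       ∎)

  ·≡bot⇒⊓ᵀ≡bot : ∀ {u v} → v · u ≡ bot → v ⊓ u ᵀ ≡ bot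
  ·≡bot⇒⊓ᵀ≡bot {u} {v} vu≡bot = ⊑bot⇒≡bot (begin
    v ⊓ u ᵀ                   ≡⟨ cong (_⊓ u ᵀ) (·-identityˡ v) ⟨
    one · v ⊓ u ᵀ             ≤⟨ dedekindʳ one v (u ᵀ) ⟩
    (one ⊓ u ᵀ · v ᵀ) · v     ≡⟨ cong (λ t → (one ⊓ t) · v) (trans (sym (ᵀ-· v u)) (trans (cong _ᵀ vu≡bot) bot-ᵀ)) ⟩
    (one ⊓ bot) · v           ≤⟨ ·-monoˡ x⊓y⊑y ⟩
    bot · v                   ≡⟨ ·-zeroˡ v ⟩
    bot                       ∎)

  ·≡bot⇒swap-irreflexive : ∀ {u v} → v · u ≡ bot → u · v ⊑ ‾ one
  ·≡bot⇒swap-irreflexive {u} {v} vu≡bot = ⊓≡bot⇒⊑‾ (⊑bot⇒≡bot (begin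
    u · v ⊓ one               ≤⟨ dedekind u v one ⟩
    u · (v ⊓ u ᵀ · one)       ≡⟨ cong (λ t → u · (v ⊓ t)) (·-identityʳ (u ᵀ)) ⟩
    u · (v ⊓ u ᵀ)             ≡⟨ cong (u ·_) (·≡bot⇒⊓ᵀ≡bot vu≡bot) ⟩
    u · bot                   ≡⟨ ·-zeroʳ u ⟩
    bot                       ∎))

  acyclic-⊔ : ∀ {a b w y} → acyclic b → a ⊑ w · y ᵀ → y ᵀ · (b * · w) ≡ bot →
              acyclic (a ⊔ b)
  acyclic-⊔ {a} {b} {w} {y} b-acyclic a⊑wyᵀ ybw≡bot =
    ⊑-trans (⁺-⊔ (⊑bot⇒≡bot a·b*·a⊑bot))
            (⊔-lub b-acyclic (⊑-trans b*·a·b*⊑b*·w·yᵀ·b* (·≡bot⇒swap-irreflexive yb·bw≡bot)))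
    where
    a·b*·a⊑bot : a · (b * · a) ⊑ bot
    a·b*·a⊑bot = begin
      a · (b * · a)                       ≤⟨ ·-mono a⊑wyᵀ (·-monoʳ a⊑wyᵀ) ⟩
      (w · y ᵀ) · (b * · (w · y ᵀ))       ≡⟨ ·-assoc w (y ᵀ) _ ⟩
      w · (y ᵀ · (b * · (w · y ᵀ)))       ≡⟨ cong (λ t → w · (y ᵀ · t)) (·-assoc (b *) w (y ᵀ)) ⟨
      w · (y ᵀ · ((b * · w) · y ᵀ))       ≡⟨ cong (w ·_) (·-assoc (y ᵀ) (b * · w) (y ᵀ)) ⟨
      w · ((y ᵀ · (b * · w)) · y ᵀ)       ≡⟨ cong (λ t → w · (t · y ᵀ)) ybw≡bot ⟩
      w · (bot · y ᵀ)                     ≡⟨ trans (cong (w ·_) (·-zeroˡ (y ᵀ))) (·-zeroʳ w) ⟩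
      bot                                 ∎

    b*·a·b*⊑b*·w·yᵀ·b* : b * · (a · b *) ⊑ (b * · w) · (y ᵀ · b *)
    b*·a·b*⊑b*·w·yᵀ·b* = begin
      b * · (a · b *)                     ≤⟨ ·-monoʳ (·-monoˡ a⊑wyᵀ) ⟩
      b * · ((w · y ᵀ) · b *)             ≡⟨ cong (b * ·_) (·-assoc w (y ᵀ) (b *)) ⟩
      b * · (w · (y ᵀ · b *))             ≡⟨ ·-assoc (b *) w _ ⟨
      (b * · w) · (y ᵀ · b *)             ∎

    yb·bw≡bot : (y ᵀ · b *) · (b * · w) ≡ bot
    yb·bw≡bot = ⊑bot⇒≡bot (begin
      (y ᵀ · b *) · (b * · w)             ≡⟨ ·-assoc (y ᵀ) (b *) _ ⟩
      y ᵀ · (b * · (b * · w))             ≡⟨ cong (y ᵀ ·_) (·-assoc (b *) (b *) w) ⟨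
      y ᵀ · ((b * · b *) · w)             ≤⟨ ·-monoʳ (·-monoˡ x*·x*⊑x*) ⟩
      y ᵀ · (b * · w)                     ≡⟨ ybw≡bot ⟩
      bot                                 ∎)

theorem12p2 : ∀ {c : Level} (K : KleeneRelationAlgebra c) →
    let open KleeneRelationAlgebra K in
    TarskiRule → (p w y : S) →
    acyclic (p ⊓ ‾ one) → point w → point y →
    y ⊓ ((p *) · w) ≡ bot →
    acyclic (((w ⊓ (y ᵀ)) ⊔ (‾ w ⊓ p)) ⊓ ‾ one)
theorem12p2 K _ p w y p-acyclic w-point y-point y⊓p*w≡bot =
  acyclic-anti below-a⊔b (acyclic-⊔ b-acyclic a⊑w·yᵀ yᵀ·b*·w≡bot)
  where
  open KleeneRelationAlgebra K
  open point
  open KleeneRelationAlgebraProperties K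

  b⊑p⊓‾one : (‾ w ⊓ p) ⊓ ‾ one ⊑ p ⊓ ‾ one
  b⊑p⊓‾one = ⊓-glb (⊑-trans x⊓y⊑x x⊓y⊑y) x⊓y⊑y

  b-acyclic : acyclic ((‾ w ⊓ p) ⊓ ‾ one)
  b-acyclic = acyclic-anti b⊑p⊓‾one p-acyclic

  a⊑w·yᵀ : w ⊓ y ᵀ ⊑ w · y ᵀ
  a⊑w·yᵀ = vector-⊓ᵀ (point-vector w-point) (point-vector y-point)

  yᵀ·b*·w≡bot : y ᵀ · (((‾ w ⊓ p) ⊓ ‾ one) * · w) ≡ bot
  yᵀ·b*·w≡bot = ⊑bot⇒≡bot (⊑-trans (·-monoʳ (·-monoˡ (*-mono (⊑-trans b⊑p⊓‾one x⊓y⊑x))))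
                                  (⊑-reflexive (vector-⊓≡bot (point-vector y-point) y⊓p*w≡bot)))

  below-a⊔b : ((w ⊓ y ᵀ) ⊔ (‾ w ⊓ p)) ⊓ ‾ one ⊑ (w ⊓ y ᵀ) ⊔ ((‾ w ⊓ p) ⊓ ‾ one)
  below-a⊔b = ⊑-trans (⊑-reflexive (⊓-distribʳ-⊔ (‾ one) (w ⊓ y ᵀ) (‾ w ⊓ p)))
                      (⊔-lub (⊑-trans x⊓y⊑x x⊑x⊔y) y⊑x⊔y)
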